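{- Let $I(n,k)$ be defined as in the context and set $R_n(x)=\sum_{k=0}^{\infty} I(n,k)x^k$ for $n\ge1$. Then, as formal power series in $s$ and $x$, $$\sum_{n=1}^{\infty} R_n(x)\,(sx)^n \;=\; x\log\left(\sum_{n=0}^{\infty}\frac{s^n}{n!}\,e^{xn^2/2}\right).$$
   Context: The numbers $I(n,k)$ are defined recursively by: $I(n,k)=0$ if $k<0$ or $n<1$; $I(1,0)=1$; and for all $n\ge1$, $k\ge0$ with $(n,k)\neq(1,0)$, $$I(n,k)=\frac{1}{2(n+k-1)}\left(n^2 I(n,k-1)+\sum_{i=1}^{n-1}\sum_{j=0}^{k} i(n-i)\,I(i,j)\,I(n-i,k-j)\right).$$ (Combinatorially, $I(n,k)$ is the sum of the inverses of the orders of the automorphism groups of all pairwise non-isomorphic connected multigraphs, loops and multiple edges allowed, on $n$ vertices with cyclomatic number $k$.) -}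

module Defs where

open import Data.Nat as ℕ using (ℕ; zero; suc; _∸_; _≤ᵇ_)
open import Data.Nat.Base using () renaming (_! to fact)
open import Data.Integer using (+_; -[1+_])
open import Data.Rational using (ℚ; 0ℚ; 1ℚ; _+_; _*_; _-_; _/_)
open import Data.Bool using (if_then_else_)

ℕtoℚ : ℕ → ℚ
ℕtoℚ n = + n / 1

-- reciprocal of a natural number (with 1/0 := 0; only used with nonzero arguments)
recip : ℕ → ℚ
recip zero    = 0ℚ
recip (suc m) = + 1 / suc m

Σ< : ℕ → (ℕ → ℚ) → ℚ
Σ< zero    f = 0ℚ
Σ< (suc n) f = Σ< n f + f n

-- Σ[a..b] f = f a + ... + f b  (empty if b < a)
Σ[_⋯_] : ℕ → ℕ → (ℕ → ℚ) → ℚ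
Σ[ a ⋯ b ] f = Σ< (suc b ∸ a) (λ t → f (a ℕ.+ t))

-- The recursion is well-founded on n + k; we
-- implement it with an explicit fuel parameter, and I n k uses fuel n + k,
-- which is sufficient (every recursive call lowers n + k by at least 1).

Ifuel : ℕ → ℕ → ℕ → ℚ
Ifuel _       zero          k       = 0ℚ
Ifuel _       (suc zero)    zero    = 1ℚ
Ifuel zero    (suc n′)      k       = 0ℚ
Ifuel (suc f) (suc n′)      k       =
  recip (2 ℕ.* (suc n′ ℕ.+ k ∸ 1)) *
    (ℕtoℚ (n ℕ.* n) * prev k
     + Σ[ 1 ⋯ n ∸ 1 ] (λ i → Σ[ 0 ⋯ k ] (λ j →
         ℕtoℚ (i ℕ.* (n ∸ i)) * Ifuel f i j * Ifuel f (n ∸ i) (k ∸ j))))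
  where
  n = suc n′
  prev : ℕ → ℚ
  prev zero     = 0ℚ
  prev (suc k′) = Ifuel f n k′

I : ℕ → ℕ → ℚ
I n k = Ifuel (n ℕ.+ k) n k

-- R_n(x) = Σ_k I(n,k) x^k, as its coefficient sequence
R : ℕ → (ℕ → ℚ)
R n k = I n k

-- Formal power series in two variables s, x over ℚ:
-- F n m is the coefficient of s^n x^m.

PS : Set
PS = ℕ → ℕ → ℚ

psOne : PS
psOne zero zero = 1ℚ
psOne _    _    = 0ℚ

_⊛_ : PS → PS → PS
(F ⊛ G) n m = Σ[ 0 ⋯ n ] (λ a → Σ[ 0 ⋯ m ] (λ b → F a b * G (n ∸ a) (m ∸ b)))

psPow : PS → ℕ → PS
psPow F zero    = psOne
psPow F (suc j) = F ⊛ psPow F j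

xMul : PS → PS
xMul F n zero    = 0ℚ
xMul F n (suc m) = F n m

sgn : ℕ → ℚ
sgn zero    = 1ℚ
sgn (suc j) = Data.Rational.-_ (sgn j)

-- Since F - 1 has zero constant
-- term, (F-1)^j only has monomials of total degree ≥ j, so the coefficient of
-- s^n x^m gets contributions only from j ≤ n + m (the sum below is exact).
psLog : PS → PS
psLog F n m = Σ[ 1 ⋯ n ℕ.+ m ] (λ j → sgn (suc j) * recip j * psPow G j n m)
  where
  G : PS
  G a b = F a b - psOne a b

-- Σ_{n≥0} s^n/n! e^{x n²/2}: coefficient of s^n x^m is (n²)^m / (2^m m! n!)
expSeries : PS
expSeries n m = ℕtoℚ ((n ℕ.* n) ℕ.^ m) * recip (2 ℕ.^ m ℕ.* fact m ℕ.* fact n)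

-- Σ_{n≥1} R_n(x) (s x)^n: coefficient of s^n x^m is I(n, m-n) if n ≥ 1 and n ≤ m
lhsSeries : PS
lhsSeries zero    m = 0ℚ
lhsSeries (suc n′) m = if suc n′ ≤ᵇ m then R (suc n′) (m ∸ suc n′) else 0ℚ

-- Let E = Σ_n (s^n/n!) e^{x n²/2}, L = log E, θs = s∂/∂s and θx = x∂/∂x.
-- The Euler operators are derivations of the product of series, and for any series E
-- with E(0, x) = 1 one has the logarithmic-derivative identity E · θ(log E) = θE.
-- Since E satisfies the heat equation ∂E/∂x = ½ θs²E, and θs²E = E · ((θsL)² + θs²L),
-- cancelling the invertible factor E gives the PDE   θx L = (x/2) ((θsL)² + θs²L),
-- with initial condition L(s, 0) = log e^s = s.  Coefficientwise this PDE expresses the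
-- coefficients of x^{m+1} through those of x^{≤m}, so it has at most one solution with
-- given x⁰-coefficients.  The series A = x⁻¹ Σ_n R_n(x)(sx)^n has A(s, 0) = s, and
-- comparing coefficients, A satisfies the same PDE precisely because of the recursion
-- defining I(n, k).  Hence A = L, which is the theorem.

module Submission where

open import Defs
open import Relation.Binary.PropositionalEquality using (_≡_)
open import Data.Nat using (ℕ)

open import Data.Nat as ℕ using (zero; suc; _∸_; _≤_; _<_; z≤n; s≤s; _^_; _!)
import Data.Nat.Properties as ℕ
import Data.Nat.Tactic.RingSolver as ℕ-Solver
import Data.Integer as ℤ
import Data.Integer.Properties as ℤ
open import Data.Rational using (ℚ; mkℚ; 0ℚ; 1ℚ; _+_; _*_; _-_; -_)
open import Data.Rational.Properties
import Data.Rational.Unnormalised as ℚᵘ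
import Data.Rational.Unnormalised.Properties as ℚᵘ
open import Data.Nat.Coprimality using (1-coprimeTo) renaming (sym to Coprime-sym)
open import Relation.Nullary.Decidable using (dec⇒maybe)
open import Data.Empty using (⊥-elim)
open import Data.Sum using (inj₁; inj₂)
open import Data.Bool using (true; false)
open import Data.Unit using (tt)
open import Relation.Nullary using (yes; no)
open import Data.Nat.Induction using (<-rec)
open import Relation.Binary.PropositionalEquality using (refl; sym; trans; cong; cong₂; subst; _≢_; module ≡-Reasoning)
open import Tactic.RingSolver using (solve-∀)
open import Tactic.RingSolver.Core.AlmostCommutativeRing using (AlmostCommutativeRing; fromCommutativeRing)

open ≡-Reasoning

ℚ-ring : AlmostCommutativeRing _ _
ℚ-ring = fromCommutativeRing +-*-commutativeRing (λ x → dec⇒maybe (0ℚ ≟ x))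

ℕtoℚ-mkℚ : ∀ n → ℕtoℚ n ≡ mkℚ (ℤ.+ n) 0 (Coprime-sym (1-coprimeTo n))
ℕtoℚ-mkℚ n = normalize-coprime (Coprime-sym (1-coprimeTo n))

ℕtoℚ-suc : ∀ n → ℕtoℚ (suc n) ≡ 1ℚ + ℕtoℚ n
ℕtoℚ-suc n rewrite ℕtoℚ-mkℚ (suc n) | ℕtoℚ-mkℚ n =
  toℚᵘ-injective (ℚᵘ.≃-trans unnormalised (ℚᵘ.≃-sym (toℚᵘ-homo-+ 1ℚ (mkℚ (ℤ.+ n) 0 (Coprime-sym (1-coprimeTo n))))))
  where
  unnormalised : ℚᵘ.mkℚᵘ (ℤ.+ suc n) 0 ℚᵘ.≃ (ℚᵘ.mkℚᵘ (ℤ.+ 1) 0 ℚᵘ.+ ℚᵘ.mkℚᵘ (ℤ.+ n) 0)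
  unnormalised rewrite ℕ.*-identityʳ n | ℤ.+◃n≡+n n = ℚᵘ.*≡* refl

ℕtoℚ-+ : ∀ a b → ℕtoℚ (a ℕ.+ b) ≡ ℕtoℚ a + ℕtoℚ b
ℕtoℚ-+ zero    b = sym (+-identityˡ (ℕtoℚ b))
ℕtoℚ-+ (suc a) b = begin
  ℕtoℚ (suc (a ℕ.+ b))    ≡⟨ ℕtoℚ-suc (a ℕ.+ b) ⟩
  1ℚ + ℕtoℚ (a ℕ.+ b)     ≡⟨ cong (1ℚ +_) (ℕtoℚ-+ a b) ⟩
  1ℚ + (ℕtoℚ a + ℕtoℚ b)  ≡⟨ sym (+-assoc 1ℚ (ℕtoℚ a) (ℕtoℚ b)) ⟩
  (1ℚ + ℕtoℚ a) + ℕtoℚ b  ≡⟨ cong (_+ ℕtoℚ b) (sym (ℕtoℚ-suc a)) ⟩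
  ℕtoℚ (suc a) + ℕtoℚ b   ∎

ℕtoℚ-* : ∀ a b → ℕtoℚ (a ℕ.* b) ≡ ℕtoℚ a * ℕtoℚ b
ℕtoℚ-* zero    b = sym (*-zeroˡ (ℕtoℚ b))
ℕtoℚ-* (suc a) b = begin
  ℕtoℚ (b ℕ.+ a ℕ.* b)        ≡⟨ ℕtoℚ-+ b (a ℕ.* b) ⟩
  ℕtoℚ b + ℕtoℚ (a ℕ.* b)     ≡⟨ cong (ℕtoℚ b +_) (ℕtoℚ-* a b) ⟩
  ℕtoℚ b + ℕtoℚ a * ℕtoℚ b    ≡⟨ distribute (ℕtoℚ a) (ℕtoℚ b) ⟩
  (1ℚ + ℕtoℚ a) * ℕtoℚ b      ≡⟨ cong (_* ℕtoℚ b) (sym (ℕtoℚ-suc a)) ⟩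
  ℕtoℚ (suc a) * ℕtoℚ b       ∎
  where
  distribute : ∀ x y → y + x * y ≡ (1ℚ + x) * y
  distribute = solve-∀ ℚ-ring

recip-inverse : ∀ m → ℕtoℚ (suc m) * recip (suc m) ≡ 1ℚ
recip-inverse m rewrite ℕtoℚ-mkℚ (suc m) | normalize-coprime (1-coprimeTo (suc m)) =
  *-inverseʳ (mkℚ (ℤ.+ suc m) 0 (Coprime-sym (1-coprimeTo (suc m))))

recip-*-cancel : ∀ m x → recip (suc m) * (ℕtoℚ (suc m) * x) ≡ x
recip-*-cancel m x = begin
  recip (suc m) * (ℕtoℚ (suc m) * x)   ≡⟨ regroup (recip (suc m)) (ℕtoℚ (suc m)) x ⟩
  (ℕtoℚ (suc m) * recip (suc m)) * x   ≡⟨ cong (_* x) (recip-inverse m) ⟩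
  1ℚ * x                               ≡⟨ *-identityˡ x ⟩
  x                                    ∎
  where
  regroup : ∀ r k x → r * (k * x) ≡ (k * r) * x
  regroup = solve-∀ ℚ-ring

ℕtoℚ-cancelˡ : ∀ m {u v} → ℕtoℚ (suc m) * u ≡ ℕtoℚ (suc m) * v → u ≡ v
ℕtoℚ-cancelˡ m {u} {v} eq = begin
  u                                     ≡⟨ sym (recip-*-cancel m u) ⟩
  recip (suc m) * (ℕtoℚ (suc m) * u)    ≡⟨ cong (recip (suc m) *_) eq ⟩
  recip (suc m) * (ℕtoℚ (suc m) * v)    ≡⟨ recip-*-cancel m v ⟩
  v                                     ∎

-- recip is multiplicative (also at 0, thanks to the convention 1/0 = 0).
recip-* : ∀ a b → recip (a ℕ.* b) ≡ recip a * recip b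
recip-* zero    b       = sym (*-zeroˡ (recip b))
recip-* (suc a) zero    rewrite ℕ.*-zeroʳ a = sym (*-zeroʳ (recip (suc a)))
recip-* (suc a) (suc b) = ℕtoℚ-cancelˡ (b ℕ.+ a ℕ.* suc b) (begin
  ℕtoℚ (suc a ℕ.* suc b) * recip (suc a ℕ.* suc b)   ≡⟨ recip-inverse (b ℕ.+ a ℕ.* suc b) ⟩
  1ℚ                                                 ≡⟨ sym (cong₂ _*_ (recip-inverse a) (recip-inverse b)) ⟩
  (A * recip (suc a)) * (B * recip (suc b))          ≡⟨ interchange A (recip (suc a)) B (recip (suc b)) ⟩
  (A * B) * (recip (suc a) * recip (suc b))          ≡⟨ cong (_* (recip (suc a) * recip (suc b))) (sym (ℕtoℚ-* (suc a) (suc b))) ⟩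
  ℕtoℚ (suc a ℕ.* suc b) * (recip (suc a) * recip (suc b)) ∎)
  where
  A = ℕtoℚ (suc a)
  B = ℕtoℚ (suc b)
  interchange : ∀ x y z w → (x * y) * (z * w) ≡ (x * z) * (y * w)
  interchange = solve-∀ ℚ-ring

ℕtoℚ-*-recip-! : ∀ n → ℕtoℚ (suc n) * recip (suc n !) ≡ recip (n !)
ℕtoℚ-*-recip-! n = begin
  ℕtoℚ (suc n) * recip (suc n ℕ.* n !)           ≡⟨ cong (ℕtoℚ (suc n) *_) (recip-* (suc n) (n !)) ⟩
  ℕtoℚ (suc n) * (recip (suc n) * recip (n !))   ≡⟨ sym (*-assoc (ℕtoℚ (suc n)) _ _) ⟩
  (ℕtoℚ (suc n) * recip (suc n)) * recip (n !)   ≡⟨ cong (_* recip (n !)) (recip-inverse n) ⟩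
  1ℚ * recip (n !)                               ≡⟨ *-identityˡ (recip (n !)) ⟩
  recip (n !)                                    ∎

x-y≡0⇒x≡y : ∀ {x y} → x - y ≡ 0ℚ → x ≡ y
x-y≡0⇒x≡y {x} {y} eq = begin
  x            ≡⟨ split x y ⟩
  (x - y) + y  ≡⟨ cong (_+ y) eq ⟩
  0ℚ + y       ≡⟨ +-identityˡ y ⟩
  y            ∎
  where
  split : ∀ x y → x ≡ (x - y) + y
  split = solve-∀ ℚ-ring

+-cancelʳ : ∀ {x y} z → x + z ≡ y + z → x ≡ y
+-cancelʳ {x} {y} z eq = begin
  x            ≡⟨ undo x z ⟩
  (x + z) - z  ≡⟨ cong (_- z) eq ⟩
  (y + z) - z  ≡⟨ sym (undo y z) ⟩
  y            ∎
  where
  undo : ∀ x z → x ≡ (x + z) - z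
  undo = solve-∀ ℚ-ring

Σ-cong : ∀ n {f g : ℕ → ℚ} → (∀ t → t < n → f t ≡ g t) → Σ< n f ≡ Σ< n g
Σ-cong zero    eq = refl
Σ-cong (suc n) eq = cong₂ _+_ (Σ-cong n (λ t t<n → eq t (ℕ.m<n⇒m<1+n t<n))) (eq n (ℕ.n<1+n n))

Σ-cong′ : ∀ n {f g : ℕ → ℚ} → (∀ t → f t ≡ g t) → Σ< n f ≡ Σ< n g
Σ-cong′ n eq = Σ-cong n (λ t _ → eq t)

Σ-zero : ∀ n {f : ℕ → ℚ} → (∀ t → t < n → f t ≡ 0ℚ) → Σ< n f ≡ 0ℚ
Σ-zero zero    eq = refl
Σ-zero (suc n) eq =
  trans (cong₂ _+_ (Σ-zero n (λ t t<n → eq t (ℕ.m<n⇒m<1+n t<n))) (eq n (ℕ.n<1+n n))) (+-identityˡ 0ℚ)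

Σ-+ : ∀ n (f g : ℕ → ℚ) → Σ< n (λ t → f t + g t) ≡ Σ< n f + Σ< n g
Σ-+ zero    f g = sym (+-identityˡ 0ℚ)
Σ-+ (suc n) f g = trans (cong (_+ (f n + g n)) (Σ-+ n f g)) (interchange (Σ< n f) (Σ< n g) (f n) (g n))
  where
  interchange : ∀ a b c d → (a + b) + (c + d) ≡ (a + c) + (b + d)
  interchange = solve-∀ ℚ-ring

Σ-- : ∀ n (f g : ℕ → ℚ) → Σ< n (λ t → f t - g t) ≡ Σ< n f - Σ< n g
Σ-- zero    f g = refl
Σ-- (suc n) f g = trans (cong (_+ (f n - g n)) (Σ-- n f g)) (interchange (Σ< n f) (Σ< n g) (f n) (g n))
  where
  interchange : ∀ a b c d → (a - b) + (c - d) ≡ (a + c) - (b + d)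
  interchange = solve-∀ ℚ-ring

Σ-*ˡ : ∀ n (c : ℚ) (f : ℕ → ℚ) → c * Σ< n f ≡ Σ< n (λ t → c * f t)
Σ-*ˡ zero    c f = *-zeroʳ c
Σ-*ˡ (suc n) c f = trans (*-distribˡ-+ c (Σ< n f) (f n)) (cong (_+ (c * f n)) (Σ-*ˡ n c f))

Σ-*ʳ : ∀ n (c : ℚ) (f : ℕ → ℚ) → Σ< n f * c ≡ Σ< n (λ t → f t * c)
Σ-*ʳ zero    c f = *-zeroˡ c
Σ-*ʳ (suc n) c f = trans (*-distribʳ-+ c (Σ< n f) (f n)) (cong (_+ (f n * c)) (Σ-*ʳ n c f))

Σ-first : ∀ n (f : ℕ → ℚ) → Σ< (suc n) f ≡ f 0 + Σ< n (λ t → f (suc t))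
Σ-first zero    f = trans (+-identityˡ (f 0)) (sym (+-identityʳ (f 0)))
Σ-first (suc n) f = trans (cong (_+ f (suc n)) (Σ-first n f)) (+-assoc (f 0) _ _)

Σ-split : ∀ a b (f : ℕ → ℚ) → Σ< (a ℕ.+ b) f ≡ Σ< a f + Σ< b (λ t → f (a ℕ.+ t))
Σ-split a zero    f rewrite ℕ.+-identityʳ a = sym (+-identityʳ _)
Σ-split a (suc b) f rewrite ℕ.+-suc a b =
  trans (cong (_+ f (a ℕ.+ b)) (Σ-split a b f)) (+-assoc (Σ< a f) _ _)

Σ-truncate : ∀ n p (f : ℕ → ℚ) → p ≤ n → (∀ t → p ≤ t → f t ≡ 0ℚ) → Σ< n f ≡ Σ< p f
Σ-truncate n p f p≤n tail = begin
  Σ< n f                                      ≡⟨ cong (λ z → Σ< z f) (sym (ℕ.m+[n∸m]≡n p≤n)) ⟩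
  Σ< (p ℕ.+ (n ∸ p)) f                        ≡⟨ Σ-split p (n ∸ p) f ⟩
  Σ< p f + Σ< (n ∸ p) (λ t → f (p ℕ.+ t))     ≡⟨ cong (Σ< p f +_) (Σ-zero (n ∸ p) (λ t _ → tail (p ℕ.+ t) (ℕ.m≤m+n p t))) ⟩
  Σ< p f + 0ℚ                                 ≡⟨ +-identityʳ _ ⟩
  Σ< p f                                      ∎

Σ-single : ∀ n p (f : ℕ → ℚ) → p < n → (∀ t → t < n → t ≢ p → f t ≡ 0ℚ) → Σ< n f ≡ f p
Σ-single (suc n) p f p<n others with p ℕ.≟ n
... | yes refl = trans (cong (_+ f p) (Σ-zero n (λ t t<n → others t (ℕ.m<n⇒m<1+n t<n) (λ t≡p → ℕ.<-irrefl t≡p t<n))))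
                       (+-identityˡ (f p))
... | no p≢n   = trans (cong₂ _+_ (Σ-single n p f (ℕ.≤∧≢⇒< (ℕ.≤-pred p<n) p≢n) (λ t t<n → others t (ℕ.m<n⇒m<1+n t<n)))
                                  (others n (ℕ.n<1+n n) (λ n≡p → p≢n (sym n≡p))))
                       (+-identityʳ (f p))

Σ-reverse : ∀ n (f : ℕ → ℚ) → Σ< n f ≡ Σ< n (λ t → f (n ∸ suc t))
Σ-reverse zero    f = refl
Σ-reverse (suc n) f = begin
  Σ< n f + f n                           ≡⟨ cong (_+ f n) (Σ-reverse n f) ⟩
  Σ< n (λ t → f (n ∸ suc t)) + f n       ≡⟨ +-comm _ (f n) ⟩
  f n + Σ< n (λ t → f (n ∸ suc t))       ≡⟨ sym (Σ-first n (λ t → f (suc n ∸ suc t))) ⟩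
  Σ< (suc n) (λ t → f (suc n ∸ suc t))   ∎

Σ-swap : ∀ n m (f : ℕ → ℕ → ℚ) → Σ< n (λ a → Σ< m (f a)) ≡ Σ< m (λ b → Σ< n (λ a → f a b))
Σ-swap zero    m f = sym (Σ-zero m (λ _ _ → refl))
Σ-swap (suc n) m f = trans (cong (_+ Σ< m (f n)) (Σ-swap n m f)) (sym (Σ-+ m (λ b → Σ< n (λ a → f a b)) (f n)))

-- Interchanging a triangular double sum:  Σ_{a + c ≤ n} f a c  summed by a, or by d = a + c.
Σ-triangle : ∀ n (f : ℕ → ℕ → ℚ) →
  Σ< (suc n) (λ a → Σ< (suc (n ∸ a)) (f a)) ≡ Σ< (suc n) (λ d → Σ< (suc d) (λ a → f a (d ∸ a)))
Σ-triangle zero    f = refl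
Σ-triangle (suc n) f = begin
  Σ< (suc n) (λ a → Σ< (suc (suc n ∸ a)) (f a)) + Σ< (suc (n ∸ n)) (f (suc n))
    ≡⟨ cong₂ _+_ rows-grow (cong (λ z → Σ< (suc z) (f (suc n))) (ℕ.n∸n≡0 n)) ⟩
  Σ< (suc n) (λ a → Σ< (suc (n ∸ a)) (f a) + f a (suc n ∸ a)) + (0ℚ + f (suc n) 0)
    ≡⟨ cong (_+ (0ℚ + f (suc n) 0)) (Σ-+ (suc n) _ _) ⟩
  (Σ< (suc n) (λ a → Σ< (suc (n ∸ a)) (f a)) + Σ< (suc n) diagonal) + (0ℚ + f (suc n) 0)
    ≡⟨ cong (λ z → (z + Σ< (suc n) diagonal) + (0ℚ + f (suc n) 0)) (Σ-triangle n f) ⟩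
  (Σ< (suc n) (λ d → Σ< (suc d) (λ a → f a (d ∸ a))) + Σ< (suc n) diagonal) + (0ℚ + f (suc n) 0)
    ≡⟨ regroup (Σ< (suc n) (λ d → Σ< (suc d) (λ a → f a (d ∸ a)))) (Σ< (suc n) diagonal) (f (suc n) 0) ⟩
  Σ< (suc n) (λ d → Σ< (suc d) (λ a → f a (d ∸ a))) + (Σ< (suc n) diagonal + f (suc n) 0)
    ≡⟨ cong (λ z → Σ< (suc n) (λ d → Σ< (suc d) (λ a → f a (d ∸ a))) + (Σ< (suc n) diagonal + f (suc n) z))
            (sym (ℕ.n∸n≡0 n)) ⟩
  Σ< (suc n) (λ d → Σ< (suc d) (λ a → f a (d ∸ a))) + (Σ< (suc n) diagonal + f (suc n) (n ∸ n)) ∎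
  where
  diagonal : ℕ → ℚ
  diagonal a = f a (suc n ∸ a)
  regroup : ∀ x y z → (x + y) + (0ℚ + z) ≡ x + (y + z)
  regroup = solve-∀ ℚ-ring
  rows-grow : Σ< (suc n) (λ a → Σ< (suc (suc n ∸ a)) (f a)) ≡ Σ< (suc n) (λ a → Σ< (suc (n ∸ a)) (f a) + diagonal a)
  rows-grow = Σ-cong (suc n) (λ a a<sn →
    let sn∸a = ℕ.+-∸-assoc 1 (ℕ.≤-pred a<sn) in
    trans (cong (λ z → Σ< (suc z) (f a)) sn∸a) (cong (λ z → Σ< (suc (n ∸ a)) (f a) + f a z) (sym sn∸a)))

-- The algebra of formal power series in s, x (coefficient arrays PS)

infix 4 _≋_
_≋_ : PS → PS → Set
F ≋ G = ∀ n m → F n m ≡ G n m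

𝟘 : PS
𝟘 _ _ = 0ℚ

_⊕_ : PS → PS → PS
(F ⊕ G) n m = F n m + G n m

_⊝_ : PS → PS → PS
(F ⊝ G) n m = F n m - G n m

_·_ : ℚ → PS → PS
(c · F) n m = c * F n m

⊛-cong-below : ∀ {F F′ G G′} n m →
  (∀ a b → a ≤ n → b ≤ m → F a b ≡ F′ a b) →
  (∀ a b → a ≤ n → b ≤ m → G a b ≡ G′ a b) →
  (F ⊛ G) n m ≡ (F′ ⊛ G′) n m
⊛-cong-below n m eqF eqG = Σ-cong (suc n) (λ a a≤n → Σ-cong (suc m) (λ b b≤m →
  cong₂ _*_ (eqF a b (ℕ.≤-pred a≤n) (ℕ.≤-pred b≤m)) (eqG (n ∸ a) (m ∸ b) (ℕ.m∸n≤m n a) (ℕ.m∸n≤m m b))))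

⊛-cong : ∀ {F F′ G G′} → F ≋ F′ → G ≋ G′ → (F ⊛ G) ≋ (F′ ⊛ G′)
⊛-cong eqF eqG n m = ⊛-cong-below n m (λ a b _ _ → eqF a b) (λ a b _ _ → eqG a b)

⊛-comm : ∀ F G → (F ⊛ G) ≋ (G ⊛ F)
⊛-comm F G n m =
  trans (Σ-reverse (suc n) _) (Σ-cong (suc n) (λ a a≤n →
  trans (Σ-reverse (suc m) _) (Σ-cong (suc m) (λ b b≤m →
  trans (cong₂ (λ x y → F (n ∸ a) (m ∸ b) * G x y) (ℕ.m∸[m∸n]≡n (ℕ.≤-pred a≤n)) (ℕ.m∸[m∸n]≡n (ℕ.≤-pred b≤m)))
        (*-comm (F (n ∸ a) (m ∸ b)) (G a b))))))

⊛-distribˡ : ∀ F G H → (F ⊛ (G ⊕ H)) ≋ ((F ⊛ G) ⊕ (F ⊛ H))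
⊛-distribˡ F G H n m =
  trans (Σ-cong′ (suc n) (λ a →
    trans (Σ-cong′ (suc m) (λ b → *-distribˡ-+ (F a b) (G (n ∸ a) (m ∸ b)) (H (n ∸ a) (m ∸ b))))
          (Σ-+ (suc m) _ _)))
  (Σ-+ (suc n) _ _)

⊛-distribˡ-⊝ : ∀ F G H → (F ⊛ (G ⊝ H)) ≋ ((F ⊛ G) ⊝ (F ⊛ H))
⊛-distribˡ-⊝ F G H n m =
  trans (Σ-cong′ (suc n) (λ a →
    trans (Σ-cong′ (suc m) (λ b → distrib (F a b) (G (n ∸ a) (m ∸ b)) (H (n ∸ a) (m ∸ b))))
          (Σ-- (suc m) _ _)))
  (Σ-- (suc n) _ _)
  where
  distrib : ∀ x y z → x * (y - z) ≡ x * y - x * z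
  distrib = solve-∀ ℚ-ring

⊛-scalarʳ : ∀ c F G → (F ⊛ (c · G)) ≋ (c · (F ⊛ G))
⊛-scalarʳ c F G n m = sym (trans (Σ-*ˡ (suc n) c _) (Σ-cong′ (suc n) (λ a →
  trans (Σ-*ˡ (suc m) c _) (Σ-cong′ (suc m) (λ b → commute c (F a b) (G (n ∸ a) (m ∸ b)))))))
  where
  commute : ∀ c x y → c * (x * y) ≡ x * (c * y)
  commute = solve-∀ ℚ-ring

⊛-identityˡ : ∀ F → (psOne ⊛ F) ≋ F
⊛-identityˡ F n m =
  trans (Σ-single (suc n) 0 _ (s≤s z≤n) other-rows)
  (trans (Σ-single (suc m) 0 _ (s≤s z≤n) other-columns) (*-identityˡ (F n m)))
  where
  other-rows : ∀ a → a < suc n → a ≢ 0 → Σ< (suc m) (λ b → psOne a b * F (n ∸ a) (m ∸ b)) ≡ 0ℚ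
  other-rows zero    _ a≢0 = ⊥-elim (a≢0 refl)
  other-rows (suc a) _ _   = Σ-zero (suc m) (λ b _ → *-zeroˡ (F (n ∸ suc a) (m ∸ b)))
  other-columns : ∀ b → b < suc m → b ≢ 0 → psOne 0 b * F n (m ∸ b) ≡ 0ℚ
  other-columns zero    _ b≢0 = ⊥-elim (b≢0 refl)
  other-columns (suc b) _ _   = *-zeroˡ (F n (m ∸ suc b))

⊛-identityʳ : ∀ F → (F ⊛ psOne) ≋ F
⊛-identityʳ F n m = trans (⊛-comm F psOne n m) (⊛-identityˡ F n m)

-- Associativity: both sides are the sum of F a b · G c d · H e f over a + c + e = n, b + d + f = m.
⊛-assoc : ∀ F G H → (F ⊛ (G ⊛ H)) ≋ ((F ⊛ G) ⊛ H)
⊛-assoc F G H n m = begin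
  Σ< (suc n) (λ a → Σ< (suc m) (λ b → F a b * Σ< (suc (n ∸ a)) (λ c → Σ< (suc (m ∸ b)) (λ d → G c d * H (n ∸ a ∸ c) (m ∸ b ∸ d)))))
    ≡⟨ Σ-cong′ (suc n) (λ a → Σ-cong′ (suc m) (λ b →
         trans (Σ-*ˡ (suc (n ∸ a)) (F a b) _) (Σ-cong′ (suc (n ∸ a)) (λ c → Σ-*ˡ (suc (m ∸ b)) (F a b) _)))) ⟩
  Σ< (suc n) (λ a → Σ< (suc m) (λ b → Σ< (suc (n ∸ a)) (λ c → Σ< (suc (m ∸ b)) (λ d → φ a c b d))))
    ≡⟨ Σ-cong′ (suc n) (λ a → Σ-swap (suc m) (suc (n ∸ a)) (λ b c → Σ< (suc (m ∸ b)) (φ a c b))) ⟩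
  Σ< (suc n) (λ a → Σ< (suc (n ∸ a)) (λ c → Σ< (suc m) (λ b → Σ< (suc (m ∸ b)) (φ a c b))))
    ≡⟨ Σ-cong′ (suc n) (λ a → Σ-cong′ (suc (n ∸ a)) (λ c → Σ-triangle m (φ a c))) ⟩
  Σ< (suc n) (λ a → Σ< (suc (n ∸ a)) (λ c → Σ< (suc m) (λ e → Σ< (suc e) (λ b → φ a c b (e ∸ b)))))
    ≡⟨ Σ-triangle n (λ a c → Σ< (suc m) (λ e → Σ< (suc e) (λ b → φ a c b (e ∸ b)))) ⟩
  Σ< (suc n) (λ f → Σ< (suc f) (λ a → Σ< (suc m) (λ e → Σ< (suc e) (λ b → φ a (f ∸ a) b (e ∸ b)))))
    ≡⟨ Σ-cong (suc n) (λ f f≤n → Σ-cong (suc f) (λ a a≤f → Σ-cong (suc m) (λ e e≤m → Σ-cong (suc e) (λ b b≤e →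
         trans (cong₂ (λ x y → F a b * (G (f ∸ a) (e ∸ b) * H x y))
                      (∸-∸-cancel n (ℕ.≤-pred a≤f)) (∸-∸-cancel m (ℕ.≤-pred b≤e)))
               (sym (*-assoc (F a b) (G (f ∸ a) (e ∸ b)) (H (n ∸ f) (m ∸ e)))))))) ⟩
  Σ< (suc n) (λ f → Σ< (suc f) (λ a → Σ< (suc m) (λ e → Σ< (suc e) (ψ f e a))))
    ≡⟨ sym (Σ-cong′ (suc n) (λ f → Σ-swap (suc m) (suc f) (λ e a → Σ< (suc e) (ψ f e a)))) ⟩
  Σ< (suc n) (λ f → Σ< (suc m) (λ e → Σ< (suc f) (λ a → Σ< (suc e) (ψ f e a))))
    ≡⟨ sym (Σ-cong′ (suc n) (λ f → Σ-cong′ (suc m) (λ e →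
         trans (Σ-*ʳ (suc f) (H (n ∸ f) (m ∸ e)) _) (Σ-cong′ (suc f) (λ a → Σ-*ʳ (suc e) (H (n ∸ f) (m ∸ e)) _))))) ⟩
  Σ< (suc n) (λ f → Σ< (suc m) (λ e → Σ< (suc f) (λ a → Σ< (suc e) (λ b → F a b * G (f ∸ a) (e ∸ b))) * H (n ∸ f) (m ∸ e))) ∎
  where
  φ : ℕ → ℕ → ℕ → ℕ → ℚ
  φ a c b d = F a b * (G c d * H (n ∸ a ∸ c) (m ∸ b ∸ d))
  ψ : ℕ → ℕ → ℕ → ℕ → ℚ
  ψ f e a b = (F a b * G (f ∸ a) (e ∸ b)) * H (n ∸ f) (m ∸ e)
  ∸-∸-cancel : ∀ n {a f} → a ≤ f → n ∸ a ∸ (f ∸ a) ≡ n ∸ f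
  ∸-∸-cancel n {a} {f} a≤f = trans (ℕ.∸-+-assoc n a (f ∸ a)) (cong (n ∸_) (ℕ.m+[n∸m]≡n a≤f))

⊛-s-order : ∀ X Y p q → (∀ c d → c < p → X c d ≡ 0ℚ) → (∀ c d → c < q → Y c d ≡ 0ℚ) →
  ∀ a b → a < p ℕ.+ q → (X ⊛ Y) a b ≡ 0ℚ
⊛-s-order X Y p q X-low Y-low a b a<p+q =
  Σ-zero (suc a) (λ c c≤a → Σ-zero (suc b) (λ d _ → term c d (ℕ.≤-pred c≤a)))
  where
  term : ∀ c d → c ≤ a → X c d * Y (a ∸ c) (b ∸ d) ≡ 0ℚ
  term c d c≤a with c ℕ.<? p
  ... | yes c<p = trans (cong (_* Y (a ∸ c) (b ∸ d)) (X-low c d c<p)) (*-zeroˡ (Y (a ∸ c) (b ∸ d)))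
  ... | no  c≮p = trans (cong (X c d *_) (Y-low (a ∸ c) (b ∸ d) a∸c<q)) (*-zeroʳ (X c d))
    where
    a∸c<q : a ∸ c < q
    a∸c<q = ℕ.+-cancelʳ-< c (a ∸ c) q (subst (_< q ℕ.+ c) (sym (ℕ.m∸n+n≡m c≤a))
              (ℕ.<-≤-trans a<p+q (subst (p ℕ.+ q ≤_) (ℕ.+-comm c q) (ℕ.+-monoˡ-≤ q (ℕ.≮⇒≥ c≮p)))))

⊛-xMul : ∀ F Y → (F ⊛ xMul Y) ≋ xMul (F ⊛ Y)
⊛-xMul F Y n zero    = Σ-zero (suc n) (λ a _ → trans (+-identityˡ _) (*-zeroʳ (F a 0)))
⊛-xMul F Y n (suc m) = Σ-cong′ (suc n) (λ a → begin
  Σ< (suc m) (λ b → F a b * xMul Y (n ∸ a) (suc m ∸ b)) + F a (suc m) * xMul Y (n ∸ a) (m ∸ m)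
    ≡⟨ cong₂ _+_ (Σ-cong (suc m) (λ b b≤m → cong (λ z → F a b * xMul Y (n ∸ a) z) (ℕ.+-∸-assoc 1 (ℕ.≤-pred b≤m))))
                 (trans (cong (λ z → F a (suc m) * xMul Y (n ∸ a) z) (ℕ.n∸n≡0 m)) (*-zeroʳ (F a (suc m)))) ⟩
  Σ< (suc m) (λ b → F a b * Y (n ∸ a) (m ∸ b)) + 0ℚ
    ≡⟨ +-identityʳ _ ⟩
  Σ< (suc m) (λ b → F a b * Y (n ∸ a) (m ∸ b)) ∎)

-- A series with constant term 1 is cancellable: F ⊛ X ≋ F ⊛ Y implies X ≋ Y
-- (by induction on total degree, the constant term isolating the top coefficient).
⊛-cancelˡ : ∀ F X Y → F 0 0 ≡ 1ℚ → (F ⊛ X) ≋ (F ⊛ Y) → X ≋ Y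
⊛-cancelˡ F X Y F₀₀≡1 FX≋FY n m = x-y≡0⇒x≡y (vanish (suc (n ℕ.+ m)) n m ℕ.≤-refl)
  where
  Z : PS
  Z = X ⊝ Y
  FZ≡0 : ∀ n m → (F ⊛ Z) n m ≡ 0ℚ
  FZ≡0 n m = trans (⊛-distribˡ-⊝ F X Y n m) (trans (cong (_- (F ⊛ Y) n m) (FX≋FY n m)) (+-inverseʳ ((F ⊛ Y) n m)))
  vanish : ∀ k n m → n ℕ.+ m < k → Z n m ≡ 0ℚ
  vanish (suc k) n m n+m≤k = begin
    Z n m                                             ≡⟨ sym (*-identityˡ (Z n m)) ⟩
    1ℚ * Z n m                                        ≡⟨ cong (_* Z n m) (sym F₀₀≡1) ⟩
    F 0 0 * Z n m                                     ≡⟨ sym (Σ-single (suc m) 0 _ (s≤s z≤n) lower-columns) ⟩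
    Σ< (suc m) (λ b → F 0 b * Z n (m ∸ b))            ≡⟨ sym (Σ-single (suc n) 0 _ (s≤s z≤n) lower-rows) ⟩
    (F ⊛ Z) n m                                       ≡⟨ FZ≡0 n m ⟩
    0ℚ                                                ∎
    where
    lower-columns : ∀ b → b < suc m → b ≢ 0 → F 0 b * Z n (m ∸ b) ≡ 0ℚ
    lower-columns zero    _     b≢0 = ⊥-elim (b≢0 refl)
    lower-columns (suc b) b<sm  _   = trans (cong (F 0 (suc b) *_) (vanish k n (m ∸ suc b)
      (ℕ.<-≤-trans (ℕ.+-monoʳ-< n (ℕ.∸-monoʳ-< {o = 0} (s≤s z≤n) (ℕ.≤-pred b<sm))) (ℕ.≤-pred n+m≤k))))
      (*-zeroʳ (F 0 (suc b)))
    lower-rows : ∀ a → a < suc n → a ≢ 0 → Σ< (suc m) (λ b → F a b * Z (n ∸ a) (m ∸ b)) ≡ 0ℚ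
    lower-rows zero    _    a≢0 = ⊥-elim (a≢0 refl)
    lower-rows (suc a) a<sn _   = Σ-zero (suc m) (λ b _ → trans (cong (F (suc a) b *_) (vanish k (n ∸ suc a) (m ∸ b)
      (ℕ.<-≤-trans (ℕ.+-mono-<-≤ (ℕ.∸-monoʳ-< {o = 0} (s≤s z≤n) (ℕ.≤-pred a<sn)) (ℕ.m∸n≤m m b)) (ℕ.≤-pred n+m≤k))))
      (*-zeroʳ (F (suc a) b)))

-- Euler operators and the logarithmic derivative
--
-- For an additive weight w (e.g. w n m = n or w n m = m) the operator
-- θ F = w · F (coefficientwise) is a derivation of the product ⊛; this covers
-- θ_s = s ∂/∂s and θ_x = x ∂/∂x.

module Euler (w : ℕ → ℕ → ℕ)
  (w-additive : ∀ n m a b → a ≤ n → b ≤ m → w n m ≡ w a b ℕ.+ w (n ∸ a) (m ∸ b)) where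

  θ : PS → PS
  θ F n m = ℕtoℚ (w n m) * F n m

  leibniz : ∀ F G → θ (F ⊛ G) ≋ ((θ F ⊛ G) ⊕ (F ⊛ θ G))
  leibniz F G n m = begin
    ℕtoℚ (w n m) * Σ< (suc n) (λ a → Σ< (suc m) (λ b → F a b * G (n ∸ a) (m ∸ b)))
      ≡⟨ trans (Σ-*ˡ (suc n) (ℕtoℚ (w n m)) _) (Σ-cong′ (suc n) (λ a → Σ-*ˡ (suc m) (ℕtoℚ (w n m)) _)) ⟩
    Σ< (suc n) (λ a → Σ< (suc m) (λ b → ℕtoℚ (w n m) * (F a b * G (n ∸ a) (m ∸ b))))
      ≡⟨ Σ-cong (suc n) (λ a a≤n → Σ-cong (suc m) (λ b b≤m → split-weight a b (ℕ.≤-pred a≤n) (ℕ.≤-pred b≤m))) ⟩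
    Σ< (suc n) (λ a → Σ< (suc m) (λ b → θ F a b * G (n ∸ a) (m ∸ b) + F a b * θ G (n ∸ a) (m ∸ b)))
      ≡⟨ trans (Σ-cong′ (suc n) (λ a → Σ-+ (suc m) _ _)) (Σ-+ (suc n) _ _) ⟩
    (θ F ⊛ G) n m + (F ⊛ θ G) n m ∎
    where
    distribute : ∀ x y f g → (x + y) * (f * g) ≡ (x * f) * g + f * (y * g)
    distribute = solve-∀ ℚ-ring
    split-weight : ∀ a b → a ≤ n → b ≤ m →
      ℕtoℚ (w n m) * (F a b * G (n ∸ a) (m ∸ b)) ≡ θ F a b * G (n ∸ a) (m ∸ b) + F a b * θ G (n ∸ a) (m ∸ b)
    split-weight a b a≤n b≤m rewrite w-additive n m a b a≤n b≤m | ℕtoℚ-+ (w a b) (w (n ∸ a) (m ∸ b)) =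
      distribute (ℕtoℚ (w a b)) (ℕtoℚ (w (n ∸ a) (m ∸ b))) (F a b) (G (n ∸ a) (m ∸ b))

  -- Additivity forces w 0 0 = 0, so constants are killed by θ.
  w₀₀≡0 : w 0 0 ≡ 0
  w₀₀≡0 = ℕ.+-cancelˡ-≡ (w 0 0) (w 0 0) 0 (trans (sym (w-additive 0 0 0 0 z≤n z≤n)) (sym (ℕ.+-identityʳ (w 0 0))))

  θ-psOne : θ psOne ≋ 𝟘
  θ-psOne zero    zero    rewrite w₀₀≡0 = refl
  θ-psOne zero    (suc m) = *-zeroʳ (ℕtoℚ (w 0 (suc m)))
  θ-psOne (suc n) m       = *-zeroʳ (ℕtoℚ (w (suc n) m))

  -- Since θ(G^{t+1}) = (t+1) G^t θG, we have
  -- θ(log E) = Σ_t (-1)^t G^t θG, and multiplying by E = 1 + G telescopes.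
  module Logarithm (E : PS) (E-s⁰ : ∀ b → E 0 b ≡ psOne 0 b) where

    G : PS
    G a b = E a b - psOne a b

    G-s⁰ : ∀ b → G 0 b ≡ 0ℚ
    G-s⁰ b rewrite E-s⁰ b = +-inverseʳ (psOne 0 b)

    G^-order : ∀ j c d → c < j → psPow G j c d ≡ 0ℚ
    G^-order (suc j) = ⊛-s-order G (psPow G j) 1 j G-order (G^-order j)
      where
      G-order : ∀ c d → c < 1 → G c d ≡ 0ℚ
      G-order zero    d _        = G-s⁰ d
      G-order (suc c) d (s≤s ())

    -- The terms Q t = G^t θG of θ(log E); Q t has s-adic order ≥ t + 1.
    Q : ℕ → PS
    Q t = psPow G t ⊛ θ G

    Q-order : ∀ t c d → c ≤ t → Q t c d ≡ 0ℚ
    Q-order t c d c≤t = ⊛-s-order (psPow G t) (θ G) t 1 (G^-order t) θG-order c d (subst (c <_) (ℕ.+-comm 1 t) (s≤s c≤t))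
      where
      θG-order : ∀ c d → c < 1 → θ G c d ≡ 0ℚ
      θG-order zero    d _        = trans (cong (ℕtoℚ (w 0 d) *_) (G-s⁰ d)) (*-zeroʳ (ℕtoℚ (w 0 d)))
      θG-order (suc c) d (s≤s ())

    θ-pow : ∀ t → θ (psPow G (suc t)) ≋ (ℕtoℚ (suc t) · Q t)
    θ-pow zero n m = begin
      ℕtoℚ (w n m) * (G ⊛ psOne) n m    ≡⟨ cong (ℕtoℚ (w n m) *_) (⊛-identityʳ G n m) ⟩
      θ G n m                           ≡⟨ sym (*-identityˡ _) ⟩
      1ℚ * θ G n m                      ≡⟨ cong (1ℚ *_) (sym (⊛-identityˡ (θ G) n m)) ⟩
      1ℚ * (psOne ⊛ θ G) n m            ∎
    θ-pow (suc t) n m = begin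
      θ (G ⊛ psPow G (suc t)) n m
        ≡⟨ leibniz G (psPow G (suc t)) n m ⟩
      (θ G ⊛ psPow G (suc t)) n m + (G ⊛ θ (psPow G (suc t))) n m
        ≡⟨ cong₂ _+_ (⊛-comm (θ G) (psPow G (suc t)) n m) (⊛-cong {G} (λ _ _ → refl) (θ-pow t) n m) ⟩
      Q (suc t) n m + (G ⊛ (ℕtoℚ (suc t) · Q t)) n m
        ≡⟨ cong (Q (suc t) n m +_) (⊛-scalarʳ (ℕtoℚ (suc t)) G (Q t) n m) ⟩
      Q (suc t) n m + ℕtoℚ (suc t) * (G ⊛ Q t) n m
        ≡⟨ cong (λ z → Q (suc t) n m + ℕtoℚ (suc t) * z) (⊛-assoc G (psPow G t) (θ G) n m) ⟩
      Q (suc t) n m + ℕtoℚ (suc t) * Q (suc t) n m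
        ≡⟨ collect (Q (suc t) n m) (ℕtoℚ (suc t)) ⟩
      (1ℚ + ℕtoℚ (suc t)) * Q (suc t) n m
        ≡⟨ cong (_* Q (suc t) n m) (sym (ℕtoℚ-suc (suc t))) ⟩
      ℕtoℚ (suc (suc t)) * Q (suc t) n m ∎
      where
      collect : ∀ q c → q + c * q ≡ (1ℚ + c) * q
      collect = solve-∀ ℚ-ring

    θlog-partial : ℕ → PS
    θlog-partial N p q = Σ< N (λ t → sgn t * Q t p q)

    θ-log : ∀ N p q → p ≤ N → θ (psLog E) p q ≡ θlog-partial N p q
    θ-log N p q p≤N = begin
      ℕtoℚ (w p q) * Σ< (p ℕ.+ q) (λ t → sgn (suc (suc t)) * recip (suc t) * psPow G (suc t) p q)
        ≡⟨ Σ-*ˡ (p ℕ.+ q) (ℕtoℚ (w p q)) _ ⟩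
      Σ< (p ℕ.+ q) (λ t → ℕtoℚ (w p q) * (sgn (suc (suc t)) * recip (suc t) * psPow G (suc t) p q))
        ≡⟨ Σ-cong′ (p ℕ.+ q) term ⟩
      θlog-partial (p ℕ.+ q) p q
        ≡⟨ Σ-truncate (p ℕ.+ q) p _ (ℕ.m≤m+n p q) high-terms ⟩
      θlog-partial p p q
        ≡⟨ sym (Σ-truncate N p _ p≤N high-terms) ⟩
      θlog-partial N p q ∎
      where
      high-terms : ∀ t → p ≤ t → sgn t * Q t p q ≡ 0ℚ
      high-terms t p≤t = trans (cong (sgn t *_) (Q-order t p q p≤t)) (*-zeroʳ (sgn t))
      regroup : ∀ W s r P → W * (- - s * r * P) ≡ s * (r * (W * P))
      regroup = solve-∀ ℚ-ring
      term : ∀ t → ℕtoℚ (w p q) * (sgn (suc (suc t)) * recip (suc t) * psPow G (suc t) p q) ≡ sgn t * Q t p q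
      term t = begin
        ℕtoℚ (w p q) * (- - sgn t * recip (suc t) * psPow G (suc t) p q)
          ≡⟨ regroup (ℕtoℚ (w p q)) (sgn t) (recip (suc t)) (psPow G (suc t) p q) ⟩
        sgn t * (recip (suc t) * θ (psPow G (suc t)) p q)
          ≡⟨ cong (λ z → sgn t * (recip (suc t) * z)) (θ-pow t p q) ⟩
        sgn t * (recip (suc t) * (ℕtoℚ (suc t) * Q t p q))
          ≡⟨ cong (sgn t *_) (recip-*-cancel t (Q t p q)) ⟩
        sgn t * Q t p q ∎

    -- Telescoping: E · Σ_{t<N} (-1)^t Q t = θG - (-1)^N Q N, using E = 1 + G and G Q t = Q (t+1).
    telescope : ∀ N n m → (E ⊛ θlog-partial N) n m ≡ θ G n m - sgn N * Q N n m
    telescope zero n m = begin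
      (E ⊛ 𝟘) n m                   ≡⟨ Σ-zero (suc n) (λ a _ → Σ-zero (suc m) (λ b _ → *-zeroʳ (E a b))) ⟩
      0ℚ                            ≡⟨ sym (+-inverseʳ (θ G n m)) ⟩
      θ G n m - θ G n m             ≡⟨ cong (λ z → θ G n m - z) (sym (trans (*-identityˡ _) (⊛-identityˡ (θ G) n m))) ⟩
      θ G n m - 1ℚ * Q zero n m     ∎
    telescope (suc N) n m = begin
      (E ⊛ (θlog-partial N ⊕ (sgn N · Q N))) n m
        ≡⟨ ⊛-distribˡ E (θlog-partial N) (sgn N · Q N) n m ⟩
      (E ⊛ θlog-partial N) n m + (E ⊛ (sgn N · Q N)) n m
        ≡⟨ cong₂ _+_ (telescope N n m) (⊛-scalarʳ (sgn N) E (Q N) n m) ⟩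
      (θ G n m - sgn N * Q N n m) + sgn N * (E ⊛ Q N) n m
        ≡⟨ cong (λ z → (θ G n m - sgn N * Q N n m) + sgn N * z) (E-times (Q N)) ⟩
      (θ G n m - sgn N * Q N n m) + sgn N * (Q N n m + (G ⊛ Q N) n m)
        ≡⟨ cong (λ z → (θ G n m - sgn N * Q N n m) + sgn N * (Q N n m + z)) (⊛-assoc G (psPow G N) (θ G) n m) ⟩
      (θ G n m - sgn N * Q N n m) + sgn N * (Q N n m + Q (suc N) n m)
        ≡⟨ cancel (θ G n m) (sgn N) (Q N n m) (Q (suc N) n m) ⟩
      θ G n m - (- sgn N) * Q (suc N) n m ∎
      where
      cancel : ∀ x s q q′ → (x - s * q) + s * (q + q′) ≡ x - (- s) * q′
      cancel = solve-∀ ℚ-ring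
      E≡1+G : ∀ n m → E n m ≡ psOne n m + G n m
      E≡1+G n m = split (E n m) (psOne n m)
        where
        split : ∀ e o → e ≡ o + (e - o)
        split = solve-∀ ℚ-ring
      E-times : ∀ X → (E ⊛ X) n m ≡ X n m + (G ⊛ X) n m
      E-times X = begin
        (E ⊛ X) n m                         ≡⟨ ⊛-comm E X n m ⟩
        (X ⊛ E) n m                         ≡⟨ ⊛-cong {X} (λ _ _ → refl) E≡1+G n m ⟩
        (X ⊛ (psOne ⊕ G)) n m               ≡⟨ ⊛-distribˡ X psOne G n m ⟩
        (X ⊛ psOne) n m + (X ⊛ G) n m       ≡⟨ cong₂ _+_ (⊛-identityʳ X n m) (⊛-comm X G n m) ⟩
        X n m + (G ⊛ X) n m                 ∎

    log-derivative : (E ⊛ θ (psLog E)) ≋ θ E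
    log-derivative n m = begin
      (E ⊛ θ (psLog E)) n m
        ≡⟨ ⊛-cong-below {E} n m (λ _ _ _ _ → refl) (λ a b a≤n _ → θ-log n a b a≤n) ⟩
      (E ⊛ θlog-partial n) n m
        ≡⟨ telescope n n m ⟩
      θ G n m - sgn n * Q n n m
        ≡⟨ cong (λ z → θ G n m - sgn n * z) (Q-order n n m ℕ.≤-refl) ⟩
      ℕtoℚ (w n m) * (E n m - psOne n m) - sgn n * 0ℚ
        ≡⟨ expand (ℕtoℚ (w n m)) (E n m) (psOne n m) (sgn n) ⟩
      θ E n m - θ psOne n m
        ≡⟨ cong (λ z → θ E n m - z) (θ-psOne n m) ⟩
      θ E n m - 0ℚ
        ≡⟨ minus-zero (θ E n m) ⟩
      θ E n m ∎
      where
      expand : ∀ W e o s → W * (e - o) - s * 0ℚ ≡ W * e - W * o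
      expand = solve-∀ ℚ-ring
      minus-zero : ∀ x → x - 0ℚ ≡ x
      minus-zero = solve-∀ ℚ-ring

E : PS
E = expSeries

L : PS
L = psLog E

E-s⁰ : ∀ b → E 0 b ≡ psOne 0 b
E-s⁰ zero    = refl
E-s⁰ (suc b) = *-zeroˡ (recip (2 ^ suc b ℕ.* suc b ! ℕ.* 1))

E-x⁰ : ∀ a → E a 0 ≡ recip (a !)
E-x⁰ a = trans (*-identityˡ _) (cong recip (ℕ.*-identityˡ (a !)))

module Θs = Euler (λ n m → n) (λ n m a b a≤n _ → sym (ℕ.m+[n∸m]≡n a≤n))
module Θx = Euler (λ n m → m) (λ n m a b _ b≤m → sym (ℕ.m+[n∸m]≡n b≤m))
open Θs using () renaming (θ to θs)
open Θx using () renaming (θ to θx)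

-- E solves the heat equation  ∂E/∂x = ½ (s ∂/∂s)² E; coefficientwise
-- (k+1) E_{n,k+1} = ½ n² E_{n,k}, since E_{n,k} = n^{2k} / (2^k k! n!).
heat : ∀ n k → ℕtoℚ (suc k) * E n (suc k) ≡ recip 2 * θs (θs E) n k
heat n k = begin
  ℕtoℚ (suc k) * (ℕtoℚ (n ℕ.* n ℕ.* N) * recip (2 ^ suc k ℕ.* suc k ! ℕ.* n !))
    ≡⟨ cong₂ (λ u v → ℕtoℚ (suc k) * (u * v))
             (trans (ℕtoℚ-* (n ℕ.* n) N) (cong (_* ℕtoℚ N) (ℕtoℚ-* n n)))
             (trans (cong recip (denominator (2 ^ k) (k !) (n !) k))
                    (trans (recip-* 2 (suc k ℕ.* D)) (cong (recip 2 *_) (recip-* (suc k) D)))) ⟩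
  ℕtoℚ (suc k) * ((ℕtoℚ n * ℕtoℚ n * ℕtoℚ N) * (recip 2 * (recip (suc k) * recip D)))
    ≡⟨ regroup (ℕtoℚ (suc k)) (recip (suc k)) (ℕtoℚ n) (ℕtoℚ N) (recip 2) (recip D) ⟩
  recip 2 * (ℕtoℚ n * (ℕtoℚ n * (recip (suc k) * (ℕtoℚ (suc k) * (ℕtoℚ N * recip D)))))
    ≡⟨ cong (λ z → recip 2 * (ℕtoℚ n * (ℕtoℚ n * z))) (recip-*-cancel k (ℕtoℚ N * recip D)) ⟩
  recip 2 * (ℕtoℚ n * (ℕtoℚ n * (ℕtoℚ N * recip D))) ∎
  where
  N = (n ℕ.* n) ^ k
  D = 2 ^ k ℕ.* k ! ℕ.* n !
  denominator : ∀ p f g k → 2 ℕ.* p ℕ.* (suc k ℕ.* f) ℕ.* g ≡ 2 ℕ.* (suc k ℕ.* (p ℕ.* f ℕ.* g))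
  denominator = ℕ-Solver.solve-∀
  regroup : ∀ c r x N h d → c * ((x * x * N) * (h * (r * d))) ≡ h * (x * (x * (r * (c * (N * d)))))
  regroup = solve-∀ ℚ-ring

pde-rhs : PS → PS
pde-rhs X = (θs X ⊛ θs X) ⊕ θs (θs X)

-- Differentiating  E · θs L = θs E  once more:  θs² E = E · ((θs L)² + θs² L).
θs²E : θs (θs E) ≋ (E ⊛ pde-rhs L)
θs²E n m = begin
  ℕtoℚ n * θs E n m                                      ≡⟨ cong (ℕtoℚ n *_) (sym (Θs.Logarithm.log-derivative E E-s⁰ n m)) ⟩
  ℕtoℚ n * (E ⊛ θs L) n m                                ≡⟨ Θs.leibniz E (θs L) n m ⟩
  (θs E ⊛ θs L) n m + (E ⊛ θs (θs L)) n m
    ≡⟨ cong (_+ (E ⊛ θs (θs L)) n m) (⊛-cong {θs E} {E ⊛ θs L} {θs L} (λ a b → sym (Θs.Logarithm.log-derivative E E-s⁰ a b)) (λ _ _ → refl) n m) ⟩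
  ((E ⊛ θs L) ⊛ θs L) n m + (E ⊛ θs (θs L)) n m          ≡⟨ cong (_+ (E ⊛ θs (θs L)) n m) (sym (⊛-assoc E (θs L) (θs L) n m)) ⟩
  (E ⊛ (θs L ⊛ θs L)) n m + (E ⊛ θs (θs L)) n m          ≡⟨ sym (⊛-distribˡ E (θs L ⊛ θs L) (θs (θs L)) n m) ⟩
  (E ⊛ pde-rhs L) n m                                    ∎

-- Hence  θx L = (x/2) ((θs L)² + θs² L):  multiplied by E, both sides give θx E.
L-pde-series : θx L ≋ (recip 2 · xMul (pde-rhs L))
L-pde-series = ⊛-cancelˡ E (θx L) (recip 2 · xMul (pde-rhs L)) refl
  (λ n m → trans (Θx.Logarithm.log-derivative E E-s⁰ n m) (sym (E-times-rhs n m)))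
  where
  E-times-rhs : ∀ n m → (E ⊛ (recip 2 · xMul (pde-rhs L))) n m ≡ θx E n m
  E-times-rhs n m = trans (⊛-scalarʳ (recip 2) E (xMul (pde-rhs L)) n m)
                          (trans (cong (recip 2 *_) (⊛-xMul E (pde-rhs L) n m)) (by-degree m))
    where
    by-degree : ∀ m → recip 2 * xMul (E ⊛ pde-rhs L) n m ≡ θx E n m
    by-degree zero    = trans (*-zeroʳ (recip 2)) (sym (*-zeroˡ (E n 0)))
    by-degree (suc m) = trans (cong (recip 2 *_) (sym (θs²E n m))) (sym (heat n m))

-- The coefficientwise form of the PDE  θx X = (x/2)((θs X)² + θs² X):
-- it determines the coefficients of x^{m+1} from those of x^{≤ m}.
SatisfiesPDE : PS → Set
SatisfiesPDE X = ∀ n m → ℕtoℚ (suc m) * X n (suc m) ≡ recip 2 * ((θs X ⊛ θs X) n m + ℕtoℚ n * (ℕtoℚ n * X n m))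

L-pde : SatisfiesPDE L
L-pde n m = L-pde-series n (suc m)

-- The coefficient sequence of the series s.
ι : ℕ → ℚ
ι (suc zero) = 1ℚ
ι _          = 0ℚ

ι-≢1 : ∀ j → j ≢ 1 → ι j ≡ 0ℚ
ι-≢1 zero          _   = refl
ι-≢1 (suc zero)    j≢1 = ⊥-elim (j≢1 refl)
ι-≢1 (suc (suc j)) _   = refl

ℕtoℚ-*-ι : ∀ j → ℕtoℚ j * ι j ≡ ι j
ℕtoℚ-*-ι zero          = *-zeroˡ 0ℚ
ℕtoℚ-*-ι (suc zero)    = *-identityˡ 1ℚ
ℕtoℚ-*-ι (suc (suc j)) = *-zeroʳ (ℕtoℚ (suc (suc j)))

Σ-*-ι : ∀ k (f : ℕ → ℚ) → Σ< (suc (suc k)) (λ t → f t * ι (suc k ∸ t)) ≡ f k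
Σ-*-ι k f = begin
  Σ< (suc (suc k)) (λ t → f t * ι (suc k ∸ t))   ≡⟨ Σ-single (suc (suc k)) k _ (ℕ.m<n⇒m<1+n (ℕ.n<1+n k)) others ⟩
  f k * ι (suc k ∸ k)                            ≡⟨ cong (λ j → f k * ι j) (ℕ.m+n∸n≡m 1 k) ⟩
  f k * 1ℚ                                       ≡⟨ *-identityʳ (f k) ⟩
  f k                                            ∎
  where
  others : ∀ t → t < suc (suc k) → t ≢ k → f t * ι (suc k ∸ t) ≡ 0ℚ
  others t t≤sk t≢k = trans (cong (f t *_) (ι-≢1 (suc k ∸ t) differs)) (*-zeroʳ (f t))
    where
    differs : suc k ∸ t ≢ 1
    differs sk∸t≡1 = t≢k (ℕ.suc-injective (trans (sym (cong (ℕ._+ t) sk∸t≡1)) (ℕ.m∸n+n≡m (ℕ.≤-pred t≤sk))))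

-- Σ_{1 ≤ a ≤ n+1} (1/a!) ι(n+1-a) + ι(n+1) = 1/n!, i.e. s·e^s and e^s - 1 agree up to the term s.
shifted-exp : ∀ n → Σ< (suc n) (λ t → E (suc t) 0 * ι (n ∸ t)) + ι (suc n) ≡ E n 0
shifted-exp zero    = refl
shifted-exp (suc k) = trans (cong (_+ 0ℚ) (Σ-*-ι k (λ t → E (suc t) 0))) (+-identityʳ (E (suc k) 0))

-- At x⁰ the identity  E · θs L = θs E  reads  Σ_{a ≤ n} (1/a!) (n-a) L_{n-a,0} = n/n!.
log-derivative-x⁰ : ∀ n → Σ< (suc n) (λ a → E a 0 * (ℕtoℚ (n ∸ a) * L (n ∸ a) 0)) ≡ ℕtoℚ n * E n 0
log-derivative-x⁰ n = trans (Σ-cong′ (suc n) (λ a → sym (+-identityˡ _))) (Θs.Logarithm.log-derivative E E-s⁰ n 0)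

-- Initial condition: L(s, 0) = log e^s = s; by strong induction on the s-degree.
L-x⁰ : ∀ n → L n 0 ≡ ι n
L-x⁰ = <-rec (λ n → L n 0 ≡ ι n) step
  where
  step : ∀ n → (∀ {j} → j < n → L j 0 ≡ ι j) → L n 0 ≡ ι n
  step zero     _  = refl
  step (suc n′) ih = ℕtoℚ-cancelˡ n′ (trans (+-cancelʳ {ℕtoℚ (suc n′) * L (suc n′) 0} S balance) (sym (ℕtoℚ-*-ι (suc n′))))
    where
    f : ℕ → ℚ
    f a = E a 0 * (ℕtoℚ (suc n′ ∸ a) * L (suc n′ ∸ a) 0)
    S : ℚ
    S = Σ< (suc n′) (λ t → E (suc t) 0 * ι (n′ ∸ t))
    lower-terms : Σ< (suc n′) (λ t → f (suc t)) ≡ S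
    lower-terms = Σ-cong (suc n′) (λ t t≤n′ → cong (E (suc t) 0 *_)
      (trans (cong (ℕtoℚ (n′ ∸ t) *_) (ih (s≤s (ℕ.m∸n≤m n′ t)))) (ℕtoℚ-*-ι (n′ ∸ t))))
    balance : ℕtoℚ (suc n′) * L (suc n′) 0 + S ≡ ι (suc n′) + S
    balance = begin
      ℕtoℚ (suc n′) * L (suc n′) 0 + S                    ≡⟨ cong₂ _+_ (sym (*-identityˡ (ℕtoℚ (suc n′) * L (suc n′) 0))) (sym lower-terms) ⟩
      f 0 + Σ< (suc n′) (λ t → f (suc t))                 ≡⟨ sym (Σ-first (suc n′) f) ⟩
      Σ< (suc (suc n′)) f                                 ≡⟨ log-derivative-x⁰ (suc n′) ⟩
      ℕtoℚ (suc n′) * E (suc n′) 0                        ≡⟨ cong (ℕtoℚ (suc n′) *_) (E-x⁰ (suc n′)) ⟩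
      ℕtoℚ (suc n′) * recip (suc n′ !)                    ≡⟨ ℕtoℚ-*-recip-! n′ ⟩
      recip (n′ !)                                        ≡⟨ sym (E-x⁰ n′) ⟩
      E n′ 0                                              ≡⟨ sym (shifted-exp n′) ⟩
      S + ι (suc n′)                                      ≡⟨ +-comm S (ι (suc n′)) ⟩
      ι (suc n′) + S                                      ∎

-- The recursion for I(n, k)

-- I(n, k-1), with the convention I(n, -1) = 0, for a table J of values.
I-prev : (ℕ → ℕ → ℚ) → ℕ → ℕ → ℚ
I-prev J n zero    = 0ℚ
I-prev J n (suc k) = J n k

I-rhs : (ℕ → ℕ → ℚ) → ℕ → ℕ → ℚ
I-rhs J n′ k = recip (2 ℕ.* (suc n′ ℕ.+ k ∸ 1)) *
  (ℕtoℚ (suc n′ ℕ.* suc n′) * I-prev J (suc n′) k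
   + Σ< n′ (λ t → Σ< (suc k) (λ j → ℕtoℚ (suc t ℕ.* (n′ ∸ t)) * J (suc t) j * J (n′ ∸ t) (k ∸ j))))

Ifuel-unfold : ∀ f n′ k → 0 < n′ ℕ.+ k → Ifuel (suc f) (suc n′) k ≡ I-rhs (Ifuel f) n′ k
Ifuel-unfold f (suc n″) zero    _ = refl
Ifuel-unfold f (suc n″) (suc k) _ = refl
Ifuel-unfold f zero     (suc k) _ = refl

I-rhs-cong : ∀ J J′ n′ k → (∀ i j → i ℕ.+ j < suc n′ ℕ.+ k → J i j ≡ J′ i j) → I-rhs J n′ k ≡ I-rhs J′ n′ k
I-rhs-cong J J′ n′ k agree = cong (recip (2 ℕ.* (suc n′ ℕ.+ k ∸ 1)) *_) (cong₂ _+_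
  (cong (ℕtoℚ (suc n′ ℕ.* suc n′) *_) (previous k agree))
  (Σ-cong n′ (λ t t<n′ → Σ-cong (suc k) (λ j j≤k → cong₂ _*_
     (cong (ℕtoℚ (suc t ℕ.* (n′ ∸ t)) *_) (agree (suc t) j (s≤s (ℕ.+-mono-≤ t<n′ (ℕ.≤-pred j≤k)))))
     (agree (n′ ∸ t) (k ∸ j) (s≤s (ℕ.+-mono-≤ (ℕ.m∸n≤m n′ t) (ℕ.m∸n≤m k j))))))))
  where
  previous : ∀ k → (∀ i j → i ℕ.+ j < suc n′ ℕ.+ k → J i j ≡ J′ i j) → I-prev J (suc n′) k ≡ I-prev J′ (suc n′) k
  previous zero    _     = refl
  previous (suc k) agree = agree (suc n′) k (ℕ.+-monoʳ-< (suc n′) (ℕ.n<1+n k))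

mutual
  Ifuel-stable : ∀ f g n k → n ℕ.+ k ≤ f → n ℕ.+ k ≤ g → Ifuel f n k ≡ Ifuel g n k
  Ifuel-stable f       g       zero          k       _         _         = refl
  Ifuel-stable f       g       (suc zero)    zero    _         _         = refl
  Ifuel-stable (suc f) (suc g) (suc (suc n)) k       (s≤s ≤f) (s≤s ≤g) = Ifuel-stable-step f g (suc n) k (s≤s z≤n) ≤f ≤g
  Ifuel-stable (suc f) (suc g) (suc zero)    (suc k) (s≤s ≤f) (s≤s ≤g) = Ifuel-stable-step f g zero (suc k) (s≤s z≤n) ≤f ≤g
  Ifuel-stable zero    _       (suc (suc n)) _       ()        _
  Ifuel-stable (suc f) zero    (suc (suc n)) _       _         ()
  Ifuel-stable zero    _       (suc zero)    (suc k) ()        _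
  Ifuel-stable (suc f) zero    (suc zero)    (suc k) _         ()

  Ifuel-stable-step : ∀ f g n′ k → 0 < n′ ℕ.+ k → n′ ℕ.+ k ≤ f → n′ ℕ.+ k ≤ g →
    Ifuel (suc f) (suc n′) k ≡ Ifuel (suc g) (suc n′) k
  Ifuel-stable-step f g n′ k 0<n′+k ≤f ≤g = begin
    Ifuel (suc f) (suc n′) k    ≡⟨ Ifuel-unfold f n′ k 0<n′+k ⟩
    I-rhs (Ifuel f) n′ k        ≡⟨ I-rhs-cong (Ifuel f) (Ifuel g) n′ k (λ i j i+j≤n′+k →
                                     Ifuel-stable f g i j (ℕ.≤-trans (ℕ.≤-pred i+j≤n′+k) ≤f) (ℕ.≤-trans (ℕ.≤-pred i+j≤n′+k) ≤g)) ⟩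
    I-rhs (Ifuel g) n′ k        ≡⟨ sym (Ifuel-unfold g n′ k 0<n′+k) ⟩
    Ifuel (suc g) (suc n′) k    ∎

I-unfold : ∀ n′ k → 0 < n′ ℕ.+ k → I (suc n′) k ≡ I-rhs I n′ k
I-unfold n′ k 0<n′+k = trans (Ifuel-unfold (n′ ℕ.+ k) n′ k 0<n′+k)
  (I-rhs-cong (Ifuel (n′ ℕ.+ k)) I n′ k (λ i j i+j≤n′+k → Ifuel-stable (n′ ℕ.+ k) (i ℕ.+ j) i j (ℕ.≤-pred i+j≤n′+k) ℕ.≤-refl))

-- Delayed sequences and their convolutions

-- The sequence u delayed by p places (the coefficients of x^p u(x)).
shift : ℕ → (ℕ → ℚ) → ℕ → ℚ
shift zero    u b       = u b
shift (suc p) u zero    = 0ℚ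
shift (suc p) u (suc b) = shift p u b

shift-below : ∀ p u b → b < p → shift p u b ≡ 0ℚ
shift-below (suc p) u zero    _           = refl
shift-below (suc p) u (suc b) (s≤s b<p)   = shift-below p u b b<p

shift-above : ∀ p u b → p ≤ b → shift p u b ≡ u (b ∸ p)
shift-above zero    u b       _           = refl
shift-above (suc p) u (suc b) (s≤s p≤b)   = shift-above p u b p≤b

Σ-conv-comm : ∀ n (f g : ℕ → ℚ) → Σ< (suc n) (λ b → f b * g (n ∸ b)) ≡ Σ< (suc n) (λ b → g b * f (n ∸ b))
Σ-conv-comm n f g = trans (Σ-reverse (suc n) _) (Σ-cong (suc n) (λ b b≤n →
  trans (cong (λ c → f (n ∸ b) * g c) (ℕ.m∸[m∸n]≡n (ℕ.≤-pred b≤n))) (*-comm (f (n ∸ b)) (g b))))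

Σ-conv-shift : ∀ p n u (g : ℕ → ℚ) →
  Σ< (suc (p ℕ.+ n)) (λ b → shift p u b * g (p ℕ.+ n ∸ b)) ≡ Σ< (suc n) (λ b → u b * g (n ∸ b))
Σ-conv-shift zero    n u g = refl
Σ-conv-shift (suc p) n u g = begin
  Σ< (suc (suc p ℕ.+ n)) (λ b → shift (suc p) u b * g (suc p ℕ.+ n ∸ b))
    ≡⟨ Σ-first (suc (p ℕ.+ n)) _ ⟩
  0ℚ * g (suc p ℕ.+ n) + Σ< (suc (p ℕ.+ n)) (λ b → shift p u b * g (p ℕ.+ n ∸ b))
    ≡⟨ cong₂ _+_ (*-zeroˡ (g (suc p ℕ.+ n))) (Σ-conv-shift p n u g) ⟩
  0ℚ + Σ< (suc n) (λ b → u b * g (n ∸ b))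
    ≡⟨ +-identityˡ _ ⟩
  Σ< (suc n) (λ b → u b * g (n ∸ b)) ∎

shift-conv : ∀ p q k u v →
  Σ< (suc (p ℕ.+ q ℕ.+ k)) (λ b → shift p u b * shift q v (p ℕ.+ q ℕ.+ k ∸ b)) ≡ Σ< (suc k) (λ j → u j * v (k ∸ j))
shift-conv p q k u v rewrite ℕ.+-assoc p q k = begin
  Σ< (suc (p ℕ.+ (q ℕ.+ k))) (λ b → shift p u b * shift q v (p ℕ.+ (q ℕ.+ k) ∸ b))
    ≡⟨ Σ-conv-shift p (q ℕ.+ k) u (shift q v) ⟩
  Σ< (suc (q ℕ.+ k)) (λ b → u b * shift q v (q ℕ.+ k ∸ b))
    ≡⟨ Σ-conv-comm (q ℕ.+ k) u (shift q v) ⟩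
  Σ< (suc (q ℕ.+ k)) (λ b → shift q v b * u (q ℕ.+ k ∸ b))
    ≡⟨ Σ-conv-shift q k v u ⟩
  Σ< (suc k) (λ b → v b * u (k ∸ b))
    ≡⟨ Σ-conv-comm k v u ⟩
  Σ< (suc k) (λ j → u j * v (k ∸ j)) ∎

shift-conv-vanish : ∀ p q m u v → m < p ℕ.+ q → Σ< (suc m) (λ b → shift p u b * shift q v (m ∸ b)) ≡ 0ℚ
shift-conv-vanish zero    q m u v m<q = Σ-zero (suc m) (λ b b≤m →
  trans (cong (u b *_) (shift-below q v (m ∸ b) (ℕ.≤-<-trans (ℕ.m∸n≤m m b) m<q))) (*-zeroʳ (u b)))
shift-conv-vanish (suc p) q zero    u v _ = trans (+-identityˡ _) (*-zeroˡ (shift q v 0))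
shift-conv-vanish (suc p) q (suc m) u v (s≤s m<p+q) = begin
  Σ< (suc (suc m)) (λ b → shift (suc p) u b * shift q v (suc m ∸ b))
    ≡⟨ Σ-first (suc m) _ ⟩
  0ℚ * shift q v (suc m) + Σ< (suc m) (λ b → shift p u b * shift q v (m ∸ b))
    ≡⟨ cong₂ _+_ (*-zeroˡ (shift q v (suc m))) (shift-conv-vanish p q m u v m<p+q) ⟩
  0ℚ + 0ℚ
    ≡⟨ +-identityˡ 0ℚ ⟩
  0ℚ ∎

Σ-conv-weights : ∀ m α β (f g : ℕ → ℚ) →
  Σ< (suc m) (λ b → (α * f b) * (β * g (m ∸ b))) ≡ (α * β) * Σ< (suc m) (λ b → f b * g (m ∸ b))
Σ-conv-weights m α β f g =
  trans (Σ-cong′ (suc m) (λ b → interchange α β (f b) (g (m ∸ b)))) (sym (Σ-*ˡ (suc m) (α * β) _))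
  where
  interchange : ∀ a b c d → (a * c) * (b * d) ≡ (a * b) * (c * d)
  interchange = solve-∀ ℚ-ring

-- The series A = x⁻¹ Σ_n R_n(x) (s x)^n, i.e.  A_{n,m} = I(n, m+1-n)

A : PS
A n m = lhsSeries n (suc m)

A-coeff : ∀ n′ m → n′ ≤ m → A (suc n′) m ≡ I (suc n′) (m ∸ n′)
A-coeff n′ m n′≤m with suc n′ ℕ.≤ᵇ suc m | ℕ.≤⇒≤ᵇ (s≤s n′≤m)
... | true  | _  = refl
... | false | ()

A-below : ∀ n′ m → m < n′ → A (suc n′) m ≡ 0ℚ
A-below n′ m m<n′ with suc n′ ℕ.≤ᵇ suc m | ℕ.≤ᵇ⇒≤ (suc n′) (suc m)
... | false | _       = refl
... | true  | n′≤ᵇm  = ⊥-elim (ℕ.<⇒≱ m<n′ (ℕ.≤-pred (n′≤ᵇm tt)))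

A-shift : ∀ n′ m → A (suc n′) m ≡ shift n′ (I (suc n′)) m
A-shift n′ m with n′ ℕ.≤? m
... | yes n′≤m = trans (A-coeff n′ m n′≤m) (sym (shift-above n′ (I (suc n′)) m n′≤m))
... | no  n′≰m = trans (A-below n′ m (ℕ.≰⇒> n′≰m)) (sym (shift-below n′ (I (suc n′)) m (ℕ.≰⇒> n′≰m)))

-- Initial condition: A(s, 0) = s, since I(1, 0) = 1.
A-x⁰ : ∀ n → A n 0 ≡ ι n
A-x⁰ zero          = refl
A-x⁰ (suc zero)    = refl
A-x⁰ (suc (suc n)) = A-below (suc n) 0 (s≤s z≤n)

θs-conv-s⁰ : ∀ X Y m → (θs X ⊛ θs Y) 0 m ≡ 0ℚ
θs-conv-s⁰ X Y m = trans (+-identityˡ _) (Σ-zero (suc m) (λ b _ →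
  trans (cong (_* θs Y 0 (m ∸ b)) (*-zeroˡ (X 0 b))) (*-zeroˡ (θs Y 0 (m ∸ b)))))

-- ... and in (θs X · θs Y)_{n′+1, m} the terms with a = 0 or a = n′+1 carry weight 0.
θs-conv-interior : ∀ X Y n′ m → (θs X ⊛ θs Y) (suc n′) m ≡
  Σ< n′ (λ t → Σ< (suc m) (λ b → θs X (suc t) b * θs Y (n′ ∸ t) (m ∸ b)))
θs-conv-interior X Y n′ m = begin
  Σ< (suc (suc n′)) row                        ≡⟨ Σ-first (suc n′) row ⟩
  row 0 + (Σ< n′ (λ t → row (suc t)) + row (suc n′))
    ≡⟨ cong₂ (λ u v → u + (Σ< n′ (λ t → row (suc t)) + v)) first-row last-row ⟩
  0ℚ + (Σ< n′ (λ t → row (suc t)) + 0ℚ)      ≡⟨ drop-zeros (Σ< n′ (λ t → row (suc t))) ⟩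
  Σ< n′ (λ t → row (suc t))                    ∎
  where
  row : ℕ → ℚ
  row a = Σ< (suc m) (λ b → θs X a b * θs Y (suc n′ ∸ a) (m ∸ b))
  first-row : row 0 ≡ 0ℚ
  first-row = Σ-zero (suc m) (λ b _ → trans (cong (_* θs Y (suc n′) (m ∸ b)) (*-zeroˡ (X 0 b))) (*-zeroˡ (θs Y (suc n′) (m ∸ b))))
  last-row : row (suc n′) ≡ 0ℚ
  last-row = Σ-zero (suc m) (λ b _ → trans (cong (λ c → θs X (suc n′) b * (ℕtoℚ c * Y c (m ∸ b))) (ℕ.n∸n≡0 n′))
                                          (trans (cong (θs X (suc n′) b *_) (*-zeroˡ (Y 0 (m ∸ b)))) (*-zeroʳ (θs X (suc n′) b))))
  drop-zeros : ∀ x → 0ℚ + (x + 0ℚ) ≡ x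
  drop-zeros = solve-∀ ℚ-ring

-- An interior term of (θs A)²: rows t+1 and r+1 of A are delayed by t and r,
-- so at x-degree t + r + k they give the convolution sum of the recursion for I.
A-interior : ∀ t r k →
  Σ< (suc (t ℕ.+ r ℕ.+ k)) (λ b → θs A (suc t) b * θs A (suc r) (t ℕ.+ r ℕ.+ k ∸ b)) ≡
  Σ< (suc k) (λ j → ℕtoℚ (suc t ℕ.* suc r) * I (suc t) j * I (suc r) (k ∸ j))
A-interior t r k = begin
  Σ< (suc (t ℕ.+ r ℕ.+ k)) (λ b → θs A (suc t) b * θs A (suc r) (t ℕ.+ r ℕ.+ k ∸ b))
    ≡⟨ Σ-conv-weights (t ℕ.+ r ℕ.+ k) (ℕtoℚ (suc t)) (ℕtoℚ (suc r)) (A (suc t)) (A (suc r)) ⟩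
  (ℕtoℚ (suc t) * ℕtoℚ (suc r)) * Σ< (suc (t ℕ.+ r ℕ.+ k)) (λ b → A (suc t) b * A (suc r) (t ℕ.+ r ℕ.+ k ∸ b))
    ≡⟨ cong₂ _*_ (sym (ℕtoℚ-* (suc t) (suc r)))
                 (Σ-cong′ (suc (t ℕ.+ r ℕ.+ k)) (λ b → cong₂ _*_ (A-shift t b) (A-shift r (t ℕ.+ r ℕ.+ k ∸ b)))) ⟩
  c * Σ< (suc (t ℕ.+ r ℕ.+ k)) (λ b → shift t (I (suc t)) b * shift r (I (suc r)) (t ℕ.+ r ℕ.+ k ∸ b))
    ≡⟨ cong (c *_) (shift-conv t r k (I (suc t)) (I (suc r))) ⟩
  c * Σ< (suc k) (λ j → I (suc t) j * I (suc r) (k ∸ j))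
    ≡⟨ trans (Σ-*ˡ (suc k) c _) (Σ-cong′ (suc k) (λ j → sym (*-assoc c (I (suc t) j) (I (suc r) (k ∸ j))))) ⟩
  Σ< (suc k) (λ j → c * I (suc t) j * I (suc r) (k ∸ j)) ∎
  where
  c = ℕtoℚ (suc t ℕ.* suc r)

A-interior-vanish : ∀ t r m → m < t ℕ.+ r →
  Σ< (suc m) (λ b → θs A (suc t) b * θs A (suc r) (m ∸ b)) ≡ 0ℚ
A-interior-vanish t r m m<t+r = begin
  Σ< (suc m) (λ b → θs A (suc t) b * θs A (suc r) (m ∸ b))
    ≡⟨ Σ-conv-weights m (ℕtoℚ (suc t)) (ℕtoℚ (suc r)) (A (suc t)) (A (suc r)) ⟩
  (ℕtoℚ (suc t) * ℕtoℚ (suc r)) * Σ< (suc m) (λ b → A (suc t) b * A (suc r) (m ∸ b))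
    ≡⟨ cong ((ℕtoℚ (suc t) * ℕtoℚ (suc r)) *_)
            (trans (Σ-cong′ (suc m) (λ b → cong₂ _*_ (A-shift t b) (A-shift r (m ∸ b))))
                   (shift-conv-vanish t r m (I (suc t)) (I (suc r)) m<t+r)) ⟩
  (ℕtoℚ (suc t) * ℕtoℚ (suc r)) * 0ℚ
    ≡⟨ *-zeroʳ (ℕtoℚ (suc t) * ℕtoℚ (suc r)) ⟩
  0ℚ ∎

A-interior-row : ∀ n′ m k t → t < n′ → n′ ℕ.+ k ≡ suc m →
  Σ< (suc m) (λ b → θs A (suc t) b * θs A (n′ ∸ t) (m ∸ b)) ≡
  Σ< (suc k) (λ j → ℕtoℚ (suc t ℕ.* (n′ ∸ t)) * I (suc t) j * I (n′ ∸ t) (k ∸ j))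
A-interior-row n′ m k t t<n′ n′+k≡1+m = at (n′ ∸ suc t) (ℕ.+-∸-assoc 1 t<n′) degree
  where
  degree : t ℕ.+ (n′ ∸ suc t) ℕ.+ k ≡ m
  degree = ℕ.suc-injective (trans (cong (ℕ._+ k) (ℕ.m+[n∸m]≡n t<n′)) n′+k≡1+m)
  at : ∀ r → n′ ∸ t ≡ suc r → t ℕ.+ r ℕ.+ k ≡ m →
    Σ< (suc m) (λ b → θs A (suc t) b * θs A (n′ ∸ t) (m ∸ b)) ≡
    Σ< (suc k) (λ j → ℕtoℚ (suc t ℕ.* (n′ ∸ t)) * I (suc t) j * I (n′ ∸ t) (k ∸ j))
  at r n′∸t≡1+r refl rewrite n′∸t≡1+r = A-interior t r k

-- The term n² I(n, k-1) of the recursion is n² A_{n,m}.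
A-prev : ∀ n′ m → n′ ≤ suc m → I-prev I (suc n′) (suc m ∸ n′) ≡ A (suc n′) m
A-prev n′ m n′≤1+m with ℕ.m≤n⇒m<n∨m≡n n′≤1+m
... | inj₁ (s≤s n′≤m) rewrite ℕ.+-∸-assoc 1 n′≤m = sym (A-coeff n′ m n′≤m)
... | inj₂ refl       rewrite ℕ.n∸n≡0 m = sym (A-below (suc m) m (ℕ.n<1+n m))

A-interior-row-vanish : ∀ n′ m t → t < n′ → suc m < n′ →
  Σ< (suc m) (λ b → θs A (suc t) b * θs A (n′ ∸ t) (m ∸ b)) ≡ 0ℚ
A-interior-row-vanish n′ m t t<n′ 1+m<n′ rewrite ℕ.+-∸-assoc 1 t<n′ =
  A-interior-vanish t (n′ ∸ suc t) m (ℕ.≤-pred (subst (suc (suc m) ≤_) (sym (ℕ.m+[n∸m]≡n t<n′)) 1+m<n′))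

A-pde-vanishing : ∀ n′ m → suc m < n′ →
  ℕtoℚ (suc m) * A (suc n′) (suc m) ≡ recip 2 * ((θs A ⊛ θs A) (suc n′) m + ℕtoℚ (suc n′) * (ℕtoℚ (suc n′) * A (suc n′) m))
A-pde-vanishing n′ m 1+m<n′ = begin
  ℕtoℚ (suc m) * A (suc n′) (suc m)    ≡⟨ cong (ℕtoℚ (suc m) *_) (A-below n′ (suc m) 1+m<n′) ⟩
  ℕtoℚ (suc m) * 0ℚ                    ≡⟨ *-zeroʳ (ℕtoℚ (suc m)) ⟩
  0ℚ                                   ≡⟨ sym (*-zeroʳ (recip 2)) ⟩
  recip 2 * 0ℚ                         ≡⟨ cong (recip 2 *_) (sym (trans (cong₂ _+_ conv≡0 n²A≡0) (+-identityˡ 0ℚ))) ⟩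
  recip 2 * ((θs A ⊛ θs A) (suc n′) m + ℕtoℚ (suc n′) * (ℕtoℚ (suc n′) * A (suc n′) m)) ∎
  where
  conv≡0 : (θs A ⊛ θs A) (suc n′) m ≡ 0ℚ
  conv≡0 = trans (θs-conv-interior A A n′ m) (Σ-zero n′ (λ t t<n′ → A-interior-row-vanish n′ m t t<n′ 1+m<n′))
  n²A≡0 : ℕtoℚ (suc n′) * (ℕtoℚ (suc n′) * A (suc n′) m) ≡ 0ℚ
  n²A≡0 rewrite A-below n′ m (ℕ.<-trans (ℕ.n<1+n m) 1+m<n′) | *-zeroʳ (ℕtoℚ (suc n′)) = *-zeroʳ (ℕtoℚ (suc n′))

-- Where n′ ≤ m + 1, the PDE for A at (n′+1, m) is the recursion for I(n′+1, k), k = m + 1 - n′: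
-- n + k - 1 = m + 1, the term n² I(n, k-1) is n² A_{n,m}, and the double sum is (θs A)²_{n,m}.
A-pde-recursion : ∀ n′ m → n′ ≤ suc m →
  ℕtoℚ (suc m) * A (suc n′) (suc m) ≡ recip 2 * ((θs A ⊛ θs A) (suc n′) m + ℕtoℚ (suc n′) * (ℕtoℚ (suc n′) * A (suc n′) m))
A-pde-recursion n′ m n′≤1+m = begin
  ℕtoℚ (suc m) * A (suc n′) (suc m)                      ≡⟨ cong (ℕtoℚ (suc m) *_) (A-coeff n′ (suc m) n′≤1+m) ⟩
  ℕtoℚ (suc m) * I (suc n′) k                            ≡⟨ cong (ℕtoℚ (suc m) *_) (I-unfold n′ k 0<n′+k) ⟩
  ℕtoℚ (suc m) * (recip (2 ℕ.* (n′ ℕ.+ k)) * (P + S))    ≡⟨ cong (λ d → ℕtoℚ (suc m) * (recip (2 ℕ.* d) * (P + S))) n′+k≡1+m ⟩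
  ℕtoℚ (suc m) * (recip (2 ℕ.* suc m) * (P + S))         ≡⟨ cong (λ z → ℕtoℚ (suc m) * (z * (P + S))) (recip-* 2 (suc m)) ⟩
  ℕtoℚ (suc m) * ((recip 2 * recip (suc m)) * (P + S))   ≡⟨ regroup (ℕtoℚ (suc m)) (recip 2) (recip (suc m)) (P + S) ⟩
  recip 2 * (recip (suc m) * (ℕtoℚ (suc m) * (P + S)))   ≡⟨ cong (recip 2 *_) (recip-*-cancel m (P + S)) ⟩
  recip 2 * (P + S)                                      ≡⟨ cong (recip 2 *_) (trans (cong₂ _+_ P≡n²A S≡conv) (+-comm n²A _)) ⟩
  recip 2 * ((θs A ⊛ θs A) (suc n′) m + n²A)             ∎
  where
  k = suc m ∸ n′
  n′+k≡1+m : n′ ℕ.+ k ≡ suc m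
  n′+k≡1+m = ℕ.m+[n∸m]≡n n′≤1+m
  0<n′+k : 0 < n′ ℕ.+ k
  0<n′+k = subst (0 <_) (sym n′+k≡1+m) (s≤s z≤n)
  P = ℕtoℚ (suc n′ ℕ.* suc n′) * I-prev I (suc n′) k
  S = Σ< n′ (λ t → Σ< (suc k) (λ j → ℕtoℚ (suc t ℕ.* (n′ ∸ t)) * I (suc t) j * I (n′ ∸ t) (k ∸ j)))
  n²A = ℕtoℚ (suc n′) * (ℕtoℚ (suc n′) * A (suc n′) m)
  regroup : ∀ c h r x → c * ((h * r) * x) ≡ h * (r * (c * x))
  regroup = solve-∀ ℚ-ring
  P≡n²A : P ≡ n²A
  P≡n²A = trans (cong₂ _*_ (ℕtoℚ-* (suc n′) (suc n′)) (A-prev n′ m n′≤1+m)) (*-assoc (ℕtoℚ (suc n′)) _ _)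
  S≡conv : S ≡ (θs A ⊛ θs A) (suc n′) m
  S≡conv = sym (trans (θs-conv-interior A A n′ m) (Σ-cong n′ (λ t t<n′ → A-interior-row n′ m k t t<n′ n′+k≡1+m)))

A-pde : SatisfiesPDE A
A-pde zero m = both-sides-vanish (ℕtoℚ (suc m)) ((θs A ⊛ θs A) 0 m) (θs-conv-s⁰ A A m)
  where
  both-sides-vanish : ∀ c S → S ≡ 0ℚ → c * 0ℚ ≡ recip 2 * (S + ℕtoℚ 0 * (ℕtoℚ 0 * 0ℚ))
  both-sides-vanish c S refl = trans (*-zeroʳ c) (sym (*-zeroʳ (recip 2)))
A-pde (suc n′) m with n′ ℕ.≤? suc m
... | yes n′≤1+m = A-pde-recursion n′ m n′≤1+m
... | no  n′≰1+m = A-pde-vanishing n′ m (ℕ.≰⇒> n′≰1+m)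

-- Uniqueness and the theorem

pde-unique : ∀ X Y → (∀ n → X n 0 ≡ Y n 0) → SatisfiesPDE X → SatisfiesPDE Y → X ≋ Y
pde-unique X Y same-x⁰ pde-X pde-Y n m = agree m n m ℕ.≤-refl
  where
  agree : ∀ M n b → b ≤ M → X n b ≡ Y n b
  agree zero    n zero _ = same-x⁰ n
  agree (suc M) n b b≤1+M with ℕ.m≤n⇒m<n∨m≡n b≤1+M
  ... | inj₁ b<1+M = agree M n b (ℕ.≤-pred b<1+M)
  ... | inj₂ refl  = ℕtoℚ-cancelˡ M (begin
    ℕtoℚ (suc M) * X n (suc M)                                       ≡⟨ pde-X n M ⟩
    recip 2 * ((θs X ⊛ θs X) n M + ℕtoℚ n * (ℕtoℚ n * X n M))        ≡⟨ cong (recip 2 *_) (cong₂ _+_ conv-agree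
                                                                          (cong (λ z → ℕtoℚ n * (ℕtoℚ n * z)) (agree M n M ℕ.≤-refl))) ⟩
    recip 2 * ((θs Y ⊛ θs Y) n M + ℕtoℚ n * (ℕtoℚ n * Y n M))        ≡⟨ sym (pde-Y n M) ⟩
    ℕtoℚ (suc M) * Y n (suc M)                                       ∎)
    where
    θs-agree : ∀ a c → a ≤ n → c ≤ M → θs X a c ≡ θs Y a c
    θs-agree a c _ c≤M = cong (ℕtoℚ a *_) (agree M a c c≤M)
    conv-agree : (θs X ⊛ θs X) n M ≡ (θs Y ⊛ θs Y) n M
    conv-agree = ⊛-cong-below n M θs-agree θs-agree

theorem2 : ∀ (n m : ℕ) → lhsSeries n m ≡ xMul (psLog expSeries) n m
theorem2 zero    zero    = refl
theorem2 (suc n) zero    = refl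
theorem2 n       (suc m) = pde-unique A L (λ n → trans (A-x⁰ n) (sym (L-x⁰ n))) A-pde L-pde n m
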